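{- For every integer $n\ge 4$, $$\beta_b(\overrightarrow{C}(n;1,2)) = \beta_b(\overrightarrow{C}(n;1,-(n-2))) = \mathrm{diam}(\overrightarrow{C}(n;1,2)) = \left\lfloor\frac{n}{2}\right\rfloor.$$
   Context: For integers $n\ge 3$ and $b_1,\dots,b_k$, the oriented circulant graph $\overrightarrow{C}(n;b_1,\dots,b_k)$ has vertex set $\{v_0,\dots,v_{n-1}\}$ and arc set $\{v_iv_{i+b_j} : 0\le i\le n-1,\ 1\le j\le k\}$, with subscripts taken modulo $n$ (negative $b_j$ allowed). $d(u,v)$ is the length of a shortest directed path from $u$ to $v$; $e(v)=\max_u d(v,u)$ is the eccentricity; $\mathrm{diam}$ is the maximum eccentricity. An independent broadcast on an oriented graph $\overrightarrow{G}$ is a function $f:V(\overrightarrow{G})\to\{0,\dots,\mathrm{diam}(\overrightarrow{G})\}$ with $f(v)\le e(v)$ for all $v$, and $d(u,v)>f(u)$ for all distinct $u,v$ with $f(u),f(v)>0$. Its cost is $\sigma(f)=\sum_v f(v)$, and $\beta_b(\overrightarrow{G})$ is the maximum cost of an independent broadcast on $\overrightarrow{G}$. -}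

module Defs where

open import Data.Nat using (ℕ; zero; suc; _≤_; _<_; NonZero)
open import Data.Integer using (ℤ; +_; _+_)
open import Data.Integer.DivMod using (_%ℕ_)
open import Data.Fin using (Fin; toℕ)
open import Data.List using (List)
open import Data.List.Membership.Propositional using (_∈_)
open import Data.Vec using (sum; tabulate)
open import Data.Product using (Σ; ∃; ∃-syntax; _×_; _,_)
open import Relation.Nullary using (¬_)
open import Relation.Binary.PropositionalEquality using (_≡_)

Digraph : ℕ → Set₁
Digraph n = Fin n → Fin n → Set

circulant : (n : ℕ) → .{{_ : NonZero n}} → List ℤ → Digraph n
circulant n bs i j = ∃[ b ] (b ∈ bs × toℕ j ≡ ((+ toℕ i) + b) %ℕ n)

module _ {n : ℕ} (G : Digraph n) where

  data Walk : ℕ → Fin n → Fin n → Set where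
    here : ∀ {u} → Walk zero u u
    step : ∀ {k u w v} → G u w → Walk k w v → Walk (suc k) u v

  Dist : Fin n → Fin n → ℕ → Set
  Dist u v k = Walk k u v × (∀ j → j < k → ¬ Walk j u v)

  Ecc : Fin n → ℕ → Set
  Ecc v e = (∀ u → ∃[ k ] (Dist v u k × k ≤ e)) × ∃[ u ] Dist v u e

  Diam : ℕ → Set
  Diam D = (∀ v → ∃[ e ] (Ecc v e × e ≤ D)) × ∃[ v ] Ecc v D

  -- independent broadcast: f(v) ≤ e(v) (hence ≤ diam) for all v, and
  -- d(u,v) > f(u) for distinct broadcasting u, v (vacuous if v unreachable from u)
  IndepBroadcast : (Fin n → ℕ) → Set
  IndepBroadcast f =
    (∀ v → ∃[ e ] (Ecc v e × f v ≤ e)) ×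
    (∀ u v → ¬ (u ≡ v) → 0 < f u → 0 < f v → ∀ k → Dist u v k → f u < k)

  cost : (Fin n → ℕ) → ℕ
  cost f = sum (tabulate f)

  BroadcastIndep : ℕ → Set
  BroadcastIndep b =
    (∃[ f ] (IndepBroadcast f × cost f ≡ b)) ×
    (∀ f → IndepBroadcast f → cost f ≤ b)

{-# OPTIONS --safe #-}
-- In a digraph whose arcs are exactly the steps +1 and +2 around ℤ/n, the distance from u to v is
-- ⌈(v − u mod n)/2⌉, so every vertex has eccentricity ⌈(n−1)/2⌉ = ⌊n/2⌋; a single vertex broadcasting
-- at strength ⌊n/2⌋ therefore gives the lower bound. Conversely, a broadcasting vertex u together with
-- the next 2f(u) − 1 vertices clockwise forms an arc, and independence (every other broadcaster w lies
-- at distance > f(u), i.e. more than 2f(u) steps clockwise) makes these arcs pairwise disjoint, so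
-- 2σ(f) ≤ n. Since −(n−2) ≡ 2 (mod n), C(n; 1, −(n−2)) has the same arcs as C(n; 1, 2).
module Submission where

open import Defs
open import Data.Nat using (ℕ; _≤_; _∸_; _/_; NonZero)
open import Data.Integer using (+_; -_)
open import Data.List using (_∷_; [])
open import Data.Product using (_×_)

open import Data.Nat using (zero; suc; _+_; _<_; _%_; ⌊_/2⌋; ⌈_/2⌉; z≤n; s≤s; s≤s⁻¹; z<s; _≤?_; _<?_)
open import Data.Nat.Properties
open import Data.Nat.DivMod
open import Algebra.Properties.CommutativeSemigroup +-commutativeSemigroup using (interchange; x∙yz≈y∙xz; xy∙z≈xz∙y)
import Data.Integer as ℤ
import Data.Integer.Properties as ℤ
open import Data.Integer.DivMod using (_%ℕ_)
open import Data.Fin using (Fin; zero; suc; toℕ; fromℕ<; splitAt; _↑ˡ_; _↑ʳ_)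
open import Data.Fin.Properties using (toℕ-fromℕ<; toℕ-injective; toℕ<n; join-splitAt; injective⇒≤)
  renaming (_≟_ to _≟ᶠ_)
open import Data.Vec using (sum; tabulate)
open import Data.List.Relation.Unary.Any using (here; there)
open import Data.Product using (Σ; ∃-syntax; _,_; map)
open import Data.Empty using (⊥)
open import Data.Sum using (_⊎_; inj₁; inj₂; [_,_]′)
open import Function using (_∘_; id; _⇔_; mk⇔; Equivalence; Injective)
open import Relation.Nullary using (¬_; yes; no; contradiction)
open import Relation.Binary using (tri<; tri≈; tri>)
open import Relation.Binary.PropositionalEquality

n/2≡⌊n/2⌋ : ∀ n → n / 2 ≡ ⌊ n /2⌋
n/2≡⌊n/2⌋ 0 = refl
n/2≡⌊n/2⌋ 1 = refl
n/2≡⌊n/2⌋ (suc (suc n)) = trans (m/n≡1+[m∸n]/n {suc (suc n)} (s≤s (s≤s z≤n))) (cong suc (n/2≡⌊n/2⌋ n))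

n≤m+m⇒⌈n/2⌉≤m : ∀ {n m} → n ≤ m + m → ⌈ n /2⌉ ≤ m
n≤m+m⇒⌈n/2⌉≤m {m = m} le = subst (_ ≤_) (sym (n≡⌈n+n/2⌉ m)) (⌈n/2⌉-mono le)

m≤n+n⇒2+m≤[1+n]+[1+n] : ∀ {m n} → m ≤ n + n → 2 + m ≤ suc n + suc n
m≤n+n⇒2+m≤[1+n]+[1+n] {m} {n} m≤2n = s≤s (subst (suc m ≤_) (sym (+-suc n n)) (s≤s m≤2n))

m+m≤n⇒m≤⌊n/2⌋ : ∀ {m n} → m + m ≤ n → m ≤ ⌊ n /2⌋
m+m≤n⇒m≤⌊n/2⌋ {m} le = subst (_≤ _) (sym (n≡⌊n+n/2⌋ m)) (⌊n/2⌋-mono le)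

m≤⌊n/2⌋⇒m+m≤n : ∀ {m n} → m ≤ ⌊ n /2⌋ → m + m ≤ n
m≤⌊n/2⌋⇒m+m≤n {m} {n} le = begin
  m + m              ≤⟨ +-mono-≤ le (≤-trans le (⌊n/2⌋≤⌈n/2⌉ n)) ⟩
  ⌊ n /2⌋ + ⌈ n /2⌉  ≡⟨ ⌊n/2⌋+⌈n/2⌉≡n n ⟩
  n                  ∎
  where open ≤-Reasoning

m∸[n∸o]≡o+[m∸n] : ∀ {m n o} → o ≤ n → n ≤ m → m ∸ (n ∸ o) ≡ o + (m ∸ n)
m∸[n∸o]≡o+[m∸n] {m} {n} {o} o≤n n≤m = begin
  m ∸ (n ∸ o)                        ≡⟨ cong (_∸ (n ∸ o)) m≡ ⟨
  o + (m ∸ n) + (n ∸ o) ∸ (n ∸ o)    ≡⟨ m+n∸n≡m (o + (m ∸ n)) (n ∸ o) ⟩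
  o + (m ∸ n)                        ∎
  where
  open ≡-Reasoning
  m≡ : o + (m ∸ n) + (n ∸ o) ≡ m
  m≡ = begin
    o + (m ∸ n) + (n ∸ o)    ≡⟨ xy∙z≈xz∙y o (m ∸ n) (n ∸ o) ⟩
    o + (n ∸ o) + (m ∸ n)    ≡⟨ cong (_+ (m ∸ n)) (m+[n∸m]≡n o≤n) ⟩
    n + (m ∸ n)              ≡⟨ m+[n∸m]≡n n≤m ⟩
    m                        ∎

module _ {o : ℕ} .{{_ : NonZero o}} where

  [m%o+n]%o≡[m+n]%o : ∀ m n → (m % o + n) % o ≡ (m + n) % o
  [m%o+n]%o≡[m+n]%o m n = begin
    (m % o + n) % o            ≡⟨ %-distribˡ-+ (m % o) n o ⟩
    (m % o % o + n % o) % o    ≡⟨ cong (λ x → (x + n % o) % o) (m%n%n≡m%n m o) ⟩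
    (m % o + n % o) % o        ≡⟨ %-distribˡ-+ m n o ⟨
    (m + n) % o                ∎
    where open ≡-Reasoning

  [m+n%o]%o≡[m+n]%o : ∀ m n → (m + n % o) % o ≡ (m + n) % o
  [m+n%o]%o≡[m+n]%o m n = begin
    (m + n % o) % o  ≡⟨ cong (_% o) (+-comm m (n % o)) ⟩
    (n % o + m) % o  ≡⟨ [m%o+n]%o≡[m+n]%o n m ⟩
    (n + m) % o      ≡⟨ cong (_% o) (+-comm n m) ⟩
    (m + n) % o      ∎
    where open ≡-Reasoning

  [m+n]%o<m⇒[m+n]%o<n : ∀ {m n} → m < o → (m + n) % o < m → (m + n) % o < n
  [m+n]%o<m⇒[m+n]%o<n {m} {n} m<o wrapped with m + n <? o
  ... | yes m+n<o = contradiction (subst (m ≤_) (sym (m<n⇒m%n≡m m+n<o)) (m≤m+n m n)) (<⇒≱ wrapped)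
  ... | no m+n≮o = begin-strict
    (m + n) % o      ≡⟨ m≤n⇒[n∸m]%m≡n%m o≤m+n ⟨
    (m + n ∸ o) % o  ≤⟨ m%n≤m (m + n ∸ o) o ⟩
    m + n ∸ o        <⟨ ∸-monoˡ-< (+-monoˡ-< n m<o) o≤m+n ⟩
    o + n ∸ o        ≡⟨ m+n∸m≡n o n ⟩
    n                ∎
    where
    open ≤-Reasoning
    o≤m+n : o ≤ m + n
    o≤m+n = ≮⇒≥ m+n≮o

  -d%ℕo≡o∸d : ∀ {d} → 0 < d → d < o → (- (+ d)) %ℕ o ≡ o ∸ d
  -d%ℕo≡o∸d {suc d} _ d<o rewrite m<n⇒m%n≡m d<o = refl

  [m-k]%ℕo≡[m+[o∸k]]%o : ∀ m {k} → k < o → (+ m ℤ.+ - (+ k)) %ℕ o ≡ (m + (o ∸ k)) % o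
  [m-k]%ℕo≡[m+[o∸k]]%o m {k} k<o rewrite ℤ.m-n≡m⊖n m k with k ≤? m
  ... | yes k≤m rewrite ℤ.⊖-≥ k≤m = begin
    (m ∸ k) % o      ≡⟨ [m+n]%n≡m%n (m ∸ k) o ⟨
    (m ∸ k + o) % o  ≡⟨ cong (_% o) (+-∸-comm o k≤m) ⟨
    (m + o ∸ k) % o  ≡⟨ cong (_% o) (+-∸-assoc m (<⇒≤ k<o)) ⟩
    (m + (o ∸ k)) % o ∎
    where open ≡-Reasoning
  ... | no k≰m rewrite ℤ.⊖-< (≰⇒> k≰m) = begin
    (- (+ (k ∸ m))) %ℕ o  ≡⟨ -d%ℕo≡o∸d 0<k∸m (≤-<-trans (m∸n≤m k m) k<o) ⟩
    o ∸ (k ∸ m)           ≡⟨ o∸[k∸m]≡m+[o∸k] ⟩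
    m + (o ∸ k)           ≡⟨ m<n⇒m%n≡m m+[o∸k]<o ⟨
    (m + (o ∸ k)) % o     ∎
    where
    open ≡-Reasoning
    0<k∸m : 0 < k ∸ m
    0<k∸m = m<n⇒0<n∸m (≰⇒> k≰m)
    o∸[k∸m]≡m+[o∸k] : o ∸ (k ∸ m) ≡ m + (o ∸ k)
    o∸[k∸m]≡m+[o∸k] = m∸[n∸o]≡o+[m∸n] (<⇒≤ (≰⇒> k≰m)) (<⇒≤ k<o)
    m+[o∸k]<o : m + (o ∸ k) < o
    m+[o∸k]<o = subst (_< o) o∸[k∸m]≡m+[o∸k] (∸-monoʳ-< 0<k∸m (≤-trans (m∸n≤m k m) (<⇒≤ k<o)))

module _ {n : ℕ} .{{_ : NonZero n}} where

  infixl 6 _⊕_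

  _⊕_ : Fin n → ℕ → Fin n
  u ⊕ s = fromℕ< (m%n<n (toℕ u + s) n)

  toℕ-⊕ : ∀ u s → toℕ (u ⊕ s) ≡ (toℕ u + s) % n
  toℕ-⊕ u s = toℕ-fromℕ< (m%n<n (toℕ u + s) n)

  ⊕-identityʳ : ∀ u → u ⊕ 0 ≡ u
  ⊕-identityʳ u = toℕ-injective (begin
    toℕ (u ⊕ 0)        ≡⟨ toℕ-⊕ u 0 ⟩
    (toℕ u + 0) % n    ≡⟨ cong (_% n) (+-identityʳ (toℕ u)) ⟩
    toℕ u % n          ≡⟨ m<n⇒m%n≡m (toℕ<n u) ⟩
    toℕ u              ∎)
    where open ≡-Reasoning

  ⊕-assoc : ∀ u s t → u ⊕ s ⊕ t ≡ u ⊕ (s + t)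
  ⊕-assoc u s t = toℕ-injective (begin
    toℕ (u ⊕ s ⊕ t)             ≡⟨ toℕ-⊕ (u ⊕ s) t ⟩
    (toℕ (u ⊕ s) + t) % n       ≡⟨ cong (λ x → (x + t) % n) (toℕ-⊕ u s) ⟩
    ((toℕ u + s) % n + t) % n   ≡⟨ [m%o+n]%o≡[m+n]%o (toℕ u + s) t ⟩
    (toℕ u + s + t) % n         ≡⟨ cong (_% n) (+-assoc (toℕ u) s t) ⟩
    (toℕ u + (s + t)) % n       ≡⟨ toℕ-⊕ u (s + t) ⟨
    toℕ (u ⊕ (s + t))           ∎)
    where open ≡-Reasoning

  -- v − u in ℤ/n; adding n ∸ u rather than subtracting u avoids truncated subtraction.
  offset : Fin n → Fin n → ℕ
  offset u v = (toℕ v + (n ∸ toℕ u)) % n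

  offset<n : ∀ u v → offset u v < n
  offset<n u v = m%n<n (toℕ v + (n ∸ toℕ u)) n

  [u+[x+[n∸u]]]%n≡x%n : ∀ (u : Fin n) x → (toℕ u + (x + (n ∸ toℕ u))) % n ≡ x % n
  [u+[x+[n∸u]]]%n≡x%n u x = begin
    (toℕ u + (x + (n ∸ toℕ u))) % n  ≡⟨ cong (_% n) (x∙yz≈y∙xz (toℕ u) x (n ∸ toℕ u)) ⟩
    (x + (toℕ u + (n ∸ toℕ u))) % n  ≡⟨ cong (λ y → (x + y) % n) (m+[n∸m]≡n (<⇒≤ (toℕ<n u))) ⟩
    (x + n) % n                      ≡⟨ [m+n]%n≡m%n x n ⟩
    x % n                            ∎
    where open ≡-Reasoning

  offset-⊕ : ∀ u s → offset u (u ⊕ s) ≡ s % n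
  offset-⊕ u s = begin
    (toℕ (u ⊕ s) + (n ∸ toℕ u)) % n      ≡⟨ cong (λ x → (x + (n ∸ toℕ u)) % n) (toℕ-⊕ u s) ⟩
    ((toℕ u + s) % n + (n ∸ toℕ u)) % n  ≡⟨ [m%o+n]%o≡[m+n]%o (toℕ u + s) (n ∸ toℕ u) ⟩
    (toℕ u + s + (n ∸ toℕ u)) % n        ≡⟨ cong (_% n) (+-assoc (toℕ u) s _) ⟩
    (toℕ u + (s + (n ∸ toℕ u))) % n      ≡⟨ [u+[x+[n∸u]]]%n≡x%n u s ⟩
    s % n                                ∎
    where open ≡-Reasoning

  ⊕-offset : ∀ u v → u ⊕ offset u v ≡ v
  ⊕-offset u v = toℕ-injective (begin
    toℕ (u ⊕ offset u v)                     ≡⟨ toℕ-⊕ u (offset u v) ⟩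
    (toℕ u + (toℕ v + (n ∸ toℕ u)) % n) % n  ≡⟨ [m+n%o]%o≡[m+n]%o (toℕ u) _ ⟩
    (toℕ u + (toℕ v + (n ∸ toℕ u))) % n      ≡⟨ [u+[x+[n∸u]]]%n≡x%n u (toℕ v) ⟩
    toℕ v % n                                ≡⟨ m<n⇒m%n≡m (toℕ<n v) ⟩
    toℕ v                                    ∎)
    where open ≡-Reasoning

  offset-trans : ∀ u w x → offset u x ≡ (offset u w + offset w x) % n
  offset-trans u w x = begin
    offset u x                                      ≡⟨ cong (offset u) (⊕-offset w x) ⟨
    offset u (w ⊕ offset w x)                       ≡⟨ cong (λ y → offset u (y ⊕ offset w x)) (⊕-offset u w) ⟨
    offset u (u ⊕ offset u w ⊕ offset w x)          ≡⟨ cong (offset u) (⊕-assoc u (offset u w) (offset w x)) ⟩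
    offset u (u ⊕ (offset u w + offset w x))        ≡⟨ offset-⊕ u (offset u w + offset w x) ⟩
    (offset u w + offset w x) % n                   ∎
    where open ≡-Reasoning

  -- offset u x < offset u w says that x lies on the clockwise arc [u, w).
  clockwise-arcs-disjoint : ∀ {u w x} → offset u x < offset u w → offset w x < offset w u → ⊥
  clockwise-arcs-disjoint {u} {w} {x} x-in-uw x-in-wu = <-asym (before u w x x-in-uw) (before w u x x-in-wu)
    where
    before : ∀ u w x → offset u x < offset u w → offset u x < offset w x
    before u w x x-in-uw = subst (_< offset w x) (sym (offset-trans u w x))
      ([m+n]%o<m⇒[m+n]%o<n (offset<n u w) (subst (_< offset u w) (offset-trans u w x) x-in-uw))

splitSum : ∀ {n} (g : Fin n → ℕ) → Fin (sum (tabulate g)) → Σ (Fin n) (Fin ∘ g)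
splitSum {suc n} g i = [ (zero ,_) , map suc id ∘ splitSum (g ∘ suc) ]′ (splitAt (g zero) i)

joinSum : ∀ {n} (g : Fin n → ℕ) → Σ (Fin n) (Fin ∘ g) → Fin (sum (tabulate g))
joinSum {suc n} g (zero , a) = a ↑ˡ sum (tabulate (g ∘ suc))
joinSum {suc n} g (suc u , a) = g zero ↑ʳ joinSum (g ∘ suc) (u , a)

joinSum-splitSum : ∀ {n} (g : Fin n → ℕ) i → joinSum g (splitSum g i) ≡ i
joinSum-splitSum {suc n} g i with splitAt (g zero) i | join-splitAt (g zero) (sum (tabulate (g ∘ suc))) i
... | inj₁ a | join≡i = join≡i
... | inj₂ j | join≡i = trans (cong (g zero ↑ʳ_) (joinSum-splitSum (g ∘ suc) j)) join≡i

splitSum-injective : ∀ {n} (g : Fin n → ℕ) → Injective _≡_ _≡_ (splitSum g)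
splitSum-injective g {i} {j} eq =
  trans (sym (joinSum-splitSum g i)) (trans (cong (joinSum g) eq) (joinSum-splitSum g j))

injective⇒sum≤ : ∀ {n m} {g : Fin n → ℕ} (h : Σ (Fin n) (Fin ∘ g) → Fin m) →
                 Injective _≡_ _≡_ h → sum (tabulate g) ≤ m
injective⇒sum≤ {g = g} h h-injective = injective⇒≤ (λ eq → splitSum-injective g (h-injective eq))

sum-tabulate-+ : ∀ {n} (f g : Fin n → ℕ) →
                 sum (tabulate (λ i → f i + g i)) ≡ sum (tabulate f) + sum (tabulate g)
sum-tabulate-+ {zero} f g = refl
sum-tabulate-+ {suc n} f g =
  trans (cong (λ x → f zero + g zero + x) (sum-tabulate-+ (f ∘ suc) (g ∘ suc)))
        (interchange (f zero) (g zero) _ _)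

sum-tabulate-0 : ∀ n → sum (tabulate {n = n} (λ _ → 0)) ≡ 0
sum-tabulate-0 zero = refl
sum-tabulate-0 (suc n) = sum-tabulate-0 n

Fin[m+m]⇒0<m : ∀ {m} → Fin (m + m) → 0 < m
Fin[m+m]⇒0<m {suc m} _ = z<s

Dist-unique : ∀ {n} {G : Digraph n} {u v k l} → Dist G u v k → Dist G u v l → k ≡ l
Dist-unique {k = k} {l} (walk-k , minimal-k) (walk-l , minimal-l) with <-cmp k l
... | tri< k<l _ _ = contradiction walk-k (minimal-l k k<l)
... | tri≈ _ k≡l _ = k≡l
... | tri> _ _ l<k = contradiction walk-l (minimal-k l l<k)

module _ {m} (G : Digraph (suc m)) where

  pointBroadcast : ℕ → Fin (suc m) → ℕ
  pointBroadcast e zero = e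
  pointBroadcast e (suc _) = 0

  pointBroadcast-indep : ∀ {e} → (∀ v → Ecc G v e) → IndepBroadcast G (pointBroadcast e)
  pointBroadcast-indep {e} ecc = (λ v → e , ecc v , bounded v) , independent
    where
    bounded : ∀ v → pointBroadcast e v ≤ e
    bounded zero = ≤-refl
    bounded (suc _) = z≤n
    independent : ∀ u v → ¬ u ≡ v → 0 < pointBroadcast e u → 0 < pointBroadcast e v →
                  ∀ k → Dist G u v k → pointBroadcast e u < k
    independent zero zero u≢v _ _ = contradiction refl u≢v
    independent zero (suc _) _ _ ()
    independent (suc _) _ _ ()

  cost-pointBroadcast : ∀ e → cost G (pointBroadcast e) ≡ e
  cost-pointBroadcast e = trans (cong (λ x → e + x) (sum-tabulate-0 m)) (+-identityʳ e)

module StepsOfOneOrTwo {m : ℕ} (G : Digraph (suc m))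
  (arc⇔ : ∀ {u v} → G u v ⇔ (v ≡ u ⊕ 1 ⊎ v ≡ u ⊕ 2)) where

  private
    n : ℕ
    n = suc m
    open Equivalence

  walk-offset : ∀ {k u v} → Walk G k u v → ∃[ s ] (s ≤ k + k × v ≡ u ⊕ s)
  walk-offset {u = u} here = 0 , z≤n , sym (⊕-identityʳ u)
  walk-offset {suc k} {u} (step arc walk) with walk-offset walk | to arc⇔ arc
  ... | s , s≤2k , v≡w⊕s | inj₁ refl =
    1 + s , ≤-trans (n≤1+n (1 + s)) (m≤n+n⇒2+m≤[1+n]+[1+n] s≤2k) , trans v≡w⊕s (⊕-assoc u 1 s)
  ... | s , s≤2k , v≡w⊕s | inj₂ refl =
    2 + s , m≤n+n⇒2+m≤[1+n]+[1+n] s≤2k , trans v≡w⊕s (⊕-assoc u 2 s)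

  walk-⊕ : ∀ s u → Walk G ⌈ s /2⌉ u (u ⊕ s)
  walk-⊕ zero u = subst (Walk G 0 u) (sym (⊕-identityʳ u)) here
  walk-⊕ (suc zero) u = step (from arc⇔ (inj₁ refl)) here
  walk-⊕ (suc (suc s)) u =
    step (from arc⇔ (inj₂ refl)) (subst (Walk G ⌈ s /2⌉ (u ⊕ 2)) (⊕-assoc u 2 s) (walk-⊕ s (u ⊕ 2)))

  dist-offset : ∀ u v → Dist G u v ⌈ offset u v /2⌉
  dist-offset u v = subst (Walk G _ u) (⊕-offset u v) (walk-⊕ (offset u v) u) , no-shorter
    where
    no-shorter : ∀ j → j < ⌈ offset u v /2⌉ → ¬ Walk G j u v
    no-shorter j j<d walk with walk-offset walk
    ... | s , s≤2j , v≡u⊕s = <⇒≱ j<d (n≤m+m⇒⌈n/2⌉≤m (begin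
      offset u v        ≡⟨ cong (offset u) v≡u⊕s ⟩
      offset u (u ⊕ s)  ≡⟨ offset-⊕ u s ⟩
      s % n             ≤⟨ m%n≤m s n ⟩
      s                 ≤⟨ s≤2j ⟩
      j + j             ∎))
      where open ≤-Reasoning

  dist≤⌊n/2⌋ : ∀ u v → ⌈ offset u v /2⌉ ≤ ⌊ n /2⌋
  dist≤⌊n/2⌋ u v = ⌈n/2⌉-mono (s≤s⁻¹ (offset<n u v))

  ecc : ∀ u → Ecc G u ⌊ n /2⌋
  ecc u = (λ v → _ , dist-offset u v , dist≤⌊n/2⌋ u v) , u ⊕ m , farthest
    where
    farthest : Dist G u (u ⊕ m) ⌈ m /2⌉
    farthest = subst (Dist G u (u ⊕ m) ∘ ⌈_/2⌉) (trans (offset-⊕ u m) (m<n⇒m%n≡m ≤-refl))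
                     (dist-offset u (u ⊕ m))

  Ecc⇒≤⌊n/2⌋ : ∀ {u e} → Ecc G u e → e ≤ ⌊ n /2⌋
  Ecc⇒≤⌊n/2⌋ {u} (_ , w , dist-e) =
    subst (_≤ ⌊ n /2⌋) (Dist-unique (dist-offset u w) dist-e) (dist≤⌊n/2⌋ u w)

  diam : Diam G ⌊ n /2⌋
  diam = (λ v → _ , ecc v , ≤-refl) , zero , ecc zero

  cost≤⌊n/2⌋ : ∀ f → IndepBroadcast G f → cost G f ≤ ⌊ n /2⌋
  cost≤⌊n/2⌋ f (bounded , independent) = m+m≤n⇒m≤⌊n/2⌋ (begin
    cost G f + cost G f               ≡⟨ sum-tabulate-+ f f ⟨
    sum (tabulate (λ u → f u + f u))  ≤⟨ injective⇒sum≤ cover cover-injective ⟩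
    n                                 ∎)
    where
    open ≤-Reasoning

    2f≤n : ∀ u → f u + f u ≤ n
    2f≤n u with bounded u
    ... | e , ecc-e , fu≤e = m≤⌊n/2⌋⇒m+m≤n (≤-trans fu≤e (Ecc⇒≤⌊n/2⌋ ecc-e))

    2f<offset : ∀ {u w} → ¬ u ≡ w → 0 < f u → 0 < f w → f u + f u < offset u w
    2f<offset {u} {w} u≢w 0<fu 0<fw = ≰⇒> λ offset≤2f →
      <⇒≱ (independent u w u≢w 0<fu 0<fw _ (dist-offset u w)) (n≤m+m⇒⌈n/2⌉≤m offset≤2f)

    cover : Σ (Fin n) (λ u → Fin (f u + f u)) → Fin n
    cover (u , a) = u ⊕ toℕ a

    offset-cover : ∀ u (a : Fin (f u + f u)) → offset u (cover (u , a)) ≡ toℕ a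
    offset-cover u a = trans (offset-⊕ u (toℕ a)) (m<n⇒m%n≡m (<-≤-trans (toℕ<n a) (2f≤n u)))

    in-own-arc : ∀ {u w} (a : Fin (f u + f u)) → ¬ u ≡ w → 0 < f w → offset u (cover (u , a)) < offset u w
    in-own-arc {u} a u≢w 0<fw =
      subst (_< _) (sym (offset-cover u a)) (<-trans (toℕ<n a) (2f<offset u≢w (Fin[m+m]⇒0<m a) 0<fw))

    cover-injective : Injective _≡_ _≡_ cover
    cover-injective {u , a} {w , b} eq with u ≟ᶠ w
    ... | yes refl = cong (u ,_) (toℕ-injective (begin-equality
      toℕ a                     ≡⟨ offset-cover u a ⟨
      offset u (cover (u , a))  ≡⟨ cong (offset u) eq ⟩
      offset u (cover (u , b))  ≡⟨ offset-cover u b ⟩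
      toℕ b                     ∎))
    ... | no u≢w = contradiction
      (in-own-arc a u≢w (Fin[m+m]⇒0<m b))
      (λ x-in-uw → clockwise-arcs-disjoint {u = u} {w = w} {x = cover (u , a)} x-in-uw
        (subst (λ x → offset w x < offset w u) (sym eq) (in-own-arc b (u≢w ∘ sym) (Fin[m+m]⇒0<m a))))

  broadcastIndep : BroadcastIndep G ⌊ n /2⌋
  broadcastIndep =
    (pointBroadcast G ⌊ n /2⌋ , pointBroadcast-indep G ecc , cost-pointBroadcast G ⌊ n /2⌋) , cost≤⌊n/2⌋

circulant-steps⇔ : ∀ {n} .{{_ : NonZero n}} {b₁ b₂ s₁ s₂} →
                   (∀ a → (+ a ℤ.+ b₁) %ℕ n ≡ (a + s₁) % n) → (∀ a → (+ a ℤ.+ b₂) %ℕ n ≡ (a + s₂) % n) →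
                   ∀ {u v} → circulant n (b₁ ∷ b₂ ∷ []) u v ⇔ (v ≡ u ⊕ s₁ ⊎ v ≡ u ⊕ s₂)
circulant-steps⇔ {n} {b₁} {b₂} {s₁} {s₂} step₁ step₂ {u} {v} = mk⇔ to from
  where
  to : circulant n (b₁ ∷ b₂ ∷ []) u v → v ≡ u ⊕ s₁ ⊎ v ≡ u ⊕ s₂
  to (_ , here refl , eq) = inj₁ (toℕ-injective (trans eq (trans (step₁ (toℕ u)) (sym (toℕ-⊕ u s₁)))))
  to (_ , there (here refl) , eq) = inj₂ (toℕ-injective (trans eq (trans (step₂ (toℕ u)) (sym (toℕ-⊕ u s₂)))))
  from : v ≡ u ⊕ s₁ ⊎ v ≡ u ⊕ s₂ → circulant n (b₁ ∷ b₂ ∷ []) u v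
  from (inj₁ refl) = b₁ , here refl , trans (toℕ-⊕ u s₁) (sym (step₁ (toℕ u)))
  from (inj₂ refl) = b₂ , there (here refl) , trans (toℕ-⊕ u s₂) (sym (step₂ (toℕ u)))

theorem5 : (n : ℕ) → .{{_ : NonZero n}} → 4 ≤ n →
    BroadcastIndep (circulant n (+ 1 ∷ + 2 ∷ [])) (n / 2) ×
    BroadcastIndep (circulant n (+ 1 ∷ - (+ (n ∸ 2)) ∷ [])) (n / 2) ×
    Diam (circulant n (+ 1 ∷ + 2 ∷ [])) (n / 2)
theorem5 n@(suc _) 4≤n rewrite n/2≡⌊n/2⌋ n =
  C[1,2].broadcastIndep , C[1,2-n].broadcastIndep , C[1,2].diam
  where
  2≤n : 2 ≤ n
  2≤n = ≤-trans (s≤s (s≤s z≤n)) 4≤n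
  step-2-n : ∀ a → (+ a ℤ.+ - (+ (n ∸ 2))) %ℕ n ≡ (a + 2) % n
  step-2-n a = trans ([m-k]%ℕo≡[m+[o∸k]]%o a (∸-monoʳ-< z<s 2≤n))
                     (cong (λ x → (a + x) % n) (m∸[m∸n]≡n 2≤n))
  module C[1,2] =
    StepsOfOneOrTwo (circulant n (+ 1 ∷ + 2 ∷ [])) (circulant-steps⇔ (λ _ → refl) (λ _ → refl))
  module C[1,2-n] =
    StepsOfOneOrTwo (circulant n (+ 1 ∷ - (+ (n ∸ 2)) ∷ [])) (circulant-steps⇔ (λ _ → refl) step-2-n)
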